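{- Let $\ell,\beta$ be positive integers. For all sufficiently large $n\in\mathbb{N}$, $$|\mathrm{rep}_\ell(\beta^\ell n)|=\beta\,|\mathrm{rep}_\ell(n)|+\left\lceil\frac{(\beta-1)(\ell+1)}{2}\right\rceil-i$$ for some $i\in\{0,1,\ldots,\beta\}$.
   Context: Let $\Sigma_\ell=\{a_1<\cdots<a_\ell\}$ and $\mathcal{B}_\ell=a_1^*\cdots a_\ell^*$. For $n\ge0$, $\mathrm{rep}_\ell(n)$ is the $(n+1)$-st word of $\mathcal{B}_\ell$ in genealogical order (shorter words first; equal-length words ordered lexicographically), and $|w|$ denotes the length of a word $w$. -}

module Defs where

open import Data.Nat using (ℕ; zero; suc; _+_; _*_; _∸_; _<ᵇ_; _≤ᵇ_)
open import Data.Nat.DivMod using (_/_)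
open import Data.Fin using (Fin; toℕ)
open import Data.List using (List; []; _∷_; map; concatMap; filterᵇ; length; drop; head; allFin)
open import Data.Maybe using (Maybe; just; nothing)
open import Data.Bool using (Bool; true; false; _∧_; if_then_else_)

-- Letters a_1 < ... < a_ℓ are represented by Fin ℓ (a_{j+1} ↦ j), ordered by toℕ.
Letter : ℕ → Set
Letter ℓ = Fin ℓ

Word : ℕ → Set
Word ℓ = List (Letter ℓ)

allWords : (ℓ : ℕ) → ℕ → List (Word ℓ)
allWords ℓ zero    = [] ∷ []
allWords ℓ (suc m) = concatMap (λ a → map (a ∷_) (allWords ℓ m)) (allFin ℓ)

-- Membership in B_ℓ = a_1^* ⋯ a_ℓ^* : the letters are weakly increasing.
inBᵇ : {ℓ : ℕ} → Word ℓ → Bool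
inBᵇ []           = true
inBᵇ (a ∷ [])     = true
inBᵇ (a ∷ b ∷ w)  = (toℕ a ≤ᵇ toℕ b) ∧ inBᵇ (b ∷ w)

wordsB : (ℓ : ℕ) → ℕ → List (Word ℓ)
wordsB ℓ m = filterᵇ inBᵇ (allWords ℓ m)

-- Walk through lengths m, m+1, ... (genealogical order) to find the k-th word
-- (0-indexed); the fuel argument is only for termination.
repGo : (ℓ : ℕ) → (fuel m k : ℕ) → Word ℓ
repGo ℓ zero       m k = []
repGo ℓ (suc fuel) m k =
  if k <ᵇ length (wordsB ℓ m)
  then (fromMaybe (head (drop k (wordsB ℓ m))))
  else repGo ℓ fuel (suc m) (k ∸ length (wordsB ℓ m))
  where
  fromMaybe : Maybe (Word ℓ) → Word ℓ
  fromMaybe (just w) = w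
  fromMaybe nothing  = []

-- rep_ℓ(n): the (n+1)-st word of B_ℓ in genealogical order.
-- For ℓ ≥ 1 every length has at least one word of B_ℓ, so fuel n+1 suffices.
rep : (ℓ : ℕ) → ℕ → Word ℓ
rep ℓ n = repGo ℓ (suc n) zero n

ceilHalf : ℕ → ℕ
ceilHalf x = (x + 1) / 2

module Submission where

-- Write S m = #{w ∈ B_ℓ : |w| < m} for the number of words of B_ℓ shorter
-- than m.  Since rep_ℓ lists B_ℓ by increasing length, m = |rep_ℓ(n)| is
-- characterised by  S m ≤ n < S (m+1).  The number of words of B_ℓ of length m whose first letter is
--     at least a_{k+1} satisfies a Pascal recurrence; this gives the closed
--     form  ℓ! · S m = m (m+1) ⋯ (m+ℓ-1), a rising factorial.
--  2. Locating rep_ℓ(n).  Following the enumeration length by length gives the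
--     bracketing of n above, hence |rep_ℓ(n)| ≤ T ⇔ n < S (T+1).
--  3. Two product inequalities.  With β = b+1 and c = ⌈b(ℓ+1)/2⌉, comparing
--     the j-th and (ℓ-1-j)-th factors of the rising factorials pairwise gives
--       β^ℓ · S (m+1) ≤ S (βm+c+1)  and, for m ≥ c(c+ℓ),  S (βm+c) ≤ β^ℓ · S (m+1).
--  4. For n large, m = |rep_ℓ(n)| is large; multiplying S m ≤ n < S (m+1) by
--     β^ℓ and applying 3 and 2 gives βm+c-β ≤ |rep_ℓ(β^ℓ n)| ≤ βm+c.

open import Defs
open import Data.Nat using (ℕ; zero; suc; _+_; _*_; _∸_; _^_; _≤_; _<_; _<ᵇ_; _≤ᵇ_; z≤n; s≤s; _!)
open import Data.Nat.Properties
open import Data.Nat.DivMod using (_%_; m≡m%n+[m/n]*n; m%n<n; m/n*n≤m)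
open import Data.Nat.Tactic.RingSolver using (solve-∀)
open import Data.Bool using (Bool; true; false; T; _∧_; if_then_else_)
open import Data.Fin using (Fin; toℕ)
import Data.Fin as Fin
open import Data.List using (List; []; _∷_; _++_; map; concatMap; filterᵇ; length; drop; head; tabulate)
open import Data.List.Properties using (length-++; filter-++)
import Data.List.Relation.Unary.All as All
open import Data.List.Relation.Unary.All using (All; []; _∷_)
open import Data.List.Relation.Unary.All.Properties using (concat⁺; map⁺; tabulate⁺; filter⁺)
open import Data.Maybe using (just)
open import Data.Product using (Σ; _×_; _,_; proj₁; proj₂)
open import Data.Unit using (tt)
open import Function using (_∘_; id)
open import Relation.Nullary using (yes; no)
open import Relation.Binary.PropositionalEquality
open import Relation.Nullary.Decidable.Core using (T?)
open import Algebra.Properties.CommutativeSemigroup *-commutativeSemigroup using (x∙yz≈y∙xz)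

private variable A B : Set

rising : ℕ → ℕ → ℕ
rising zero    x = 1
rising (suc r) x = x * rising r (suc x)

rising-last : ∀ r x → rising (suc r) x ≡ rising r x * (x + r)
rising-last zero    x = base x
  where
  base : ∀ x → x * 1 ≡ 1 * (x + 0)
  base = solve-∀
rising-last (suc r) x = trans (cong (x *_) (rising-last r (suc x))) (regroup x (rising r (suc x)) r)
  where
  regroup : ∀ x y r → x * (y * (suc x + r)) ≡ x * y * (x + suc r)
  regroup = solve-∀

-- Pascal's rule in rising-factorial form:  C(x+r+1, r+1) = C(x+r, r+1) + C(x+r, r).
rising-pascal : ∀ r x → rising (suc r) (suc x) ≡ rising (suc r) x + suc r * rising r (suc x)
rising-pascal r x = trans (rising-last r (suc x)) (split (rising r (suc x)) x r)
  where
  split : ∀ y x r → y * (suc x + r) ≡ x * y + suc r * y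
  split = solve-∀

rising-one : ∀ r → rising r 1 ≡ r !
rising-one zero    = refl
rising-one (suc r) = trans (rising-last r 1) (trans (cong (_* suc r) (rising-one r)) (*-comm (r !) (suc r)))

rising-positive : ∀ r x → 1 ≤ rising r (suc x)
rising-positive zero    x = s≤s z≤n
rising-positive (suc r) x = *-mono-≤ {1} {suc x} (s≤s z≤n) (rising-positive r (suc x))

-- The factorial of r+1 distributes over a sum, one factor r+1 going to the second summand;
-- this is the shape of every inductive step towards a binomial closed form.
factorial-split : ∀ r a b → suc r ! * (a + b) ≡ suc r ! * a + suc r * (r ! * b)
factorial-split r a b = distrib (suc r) (r !) a b
  where
  distrib : ∀ s f a b → s * f * (a + b) ≡ s * f * a + s * (f * b)
  distrib = solve-∀

sumBelow : ℕ → (ℕ → ℕ) → ℕ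
sumBelow zero    h = 0
sumBelow (suc n) h = h 0 + sumBelow n (h ∘ suc)

sumBelow-cong : ∀ n {h h′ : ℕ → ℕ} → (∀ a → h a ≡ h′ a) → sumBelow n h ≡ sumBelow n h′
sumBelow-cong zero    e = refl
sumBelow-cong (suc n) e = cong₂ _+_ (e 0) (sumBelow-cong n (e ∘ suc))

from : ℕ → (ℕ → ℕ) → ℕ → ℕ
from k h a = if k ≤ᵇ a then h a else 0

from-suc : ∀ k h a → from (suc k) h (suc a) ≡ from k (h ∘ suc) a
from-suc zero    h a = refl
from-suc (suc k) h a = refl

sumFrom-empty : ∀ n k h → n ≤ k → sumBelow n (from k h) ≡ 0
sumFrom-empty zero    k       h _         = refl
sumFrom-empty (suc n) (suc k) h (s≤s n≤k) =
  trans (sumBelow-cong n (from-suc k h)) (sumFrom-empty n k (h ∘ suc) n≤k)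

sumFrom-split : ∀ n k h → k < n → sumBelow n (from k h) ≡ h k + sumBelow n (from (suc k) h)
sumFrom-split (suc n) zero    h _         = refl
sumFrom-split (suc n) (suc k) h (s≤s k<n) =
  trans (sumBelow-cong n (from-suc k h)) (sumFrom-split n k (h ∘ suc) k<n)

length-filter-++ : (p : A → Bool) (xs ys : List A) →
  length (filterᵇ p (xs ++ ys)) ≡ length (filterᵇ p xs) + length (filterᵇ p ys)
length-filter-++ p xs ys = trans (cong length (filter-++ (T? ∘ p) xs ys)) (length-++ (filterᵇ p xs))

length-filter-map-guarded : (p : B → Bool) (f : A → B) (b : Bool) (q : A → Bool) →
  (∀ x → p (f x) ≡ b ∧ q x) → ∀ xs →
  length (filterᵇ p (map f xs)) ≡ (if b then length (filterᵇ q xs) else 0)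
length-filter-map-guarded p f true  q e [] = refl
length-filter-map-guarded p f false q e [] = refl
length-filter-map-guarded p f true q e (x ∷ xs) with p (f x) | e x
... | .(q x) | refl with q x
...   | true  = cong suc (length-filter-map-guarded p f true q e xs)
...   | false = length-filter-map-guarded p f true q e xs
length-filter-map-guarded p f false q e (x ∷ xs) with p (f x) | e x
... | .false | refl = length-filter-map-guarded p f false q e xs

length-filter-concatMap : (p : B → Bool) (F : A → List B) (h : ℕ → ℕ) → ∀ n (f : Fin n → A) →
  (∀ i → length (filterᵇ p (F (f i))) ≡ h (toℕ i)) →
  length (filterᵇ p (concatMap F (tabulate f))) ≡ sumBelow n h
length-filter-concatMap p F h zero    f e = refl
length-filter-concatMap p F h (suc n) f e =
  trans (length-filter-++ p (F (f Fin.zero)) (concatMap F (tabulate (f ∘ Fin.suc))))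
        (cong₂ _+_ (e Fin.zero) (length-filter-concatMap p F (h ∘ suc) n (f ∘ Fin.suc) (e ∘ Fin.suc)))

length-filter-cong : {p q : A → Bool} → (∀ x → p x ≡ q x) → ∀ xs →
  length (filterᵇ p xs) ≡ length (filterᵇ q xs)
length-filter-cong e [] = refl
length-filter-cong {p = p} {q} e (x ∷ xs) with p x | q x | e x
... | true  | .true  | refl = cong suc (length-filter-cong e xs)
... | false | .false | refl = length-filter-cong e xs

module Counting (ℓ : ℕ) where

  inBFrom : ℕ → Word ℓ → Bool
  inBFrom k []      = true
  inBFrom k (a ∷ w) = (k ≤ᵇ toℕ a) ∧ inBᵇ (a ∷ w)

  count : ℕ → ℕ → ℕ
  count k m = length (filterᵇ (inBFrom k) (allWords ℓ m))

  inBFrom-cons : ∀ k a w → inBFrom k (a ∷ w) ≡ (k ≤ᵇ toℕ a) ∧ inBFrom (toℕ a) w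
  inBFrom-cons k a []      = refl
  inBFrom-cons k a (b ∷ w) = refl

  count-suc : ∀ k m → count k (suc m) ≡ sumBelow ℓ (from k (λ a → count a m))
  count-suc k m = length-filter-concatMap (inBFrom k) (λ a → map (a ∷_) (allWords ℓ m)) _ ℓ id
    (λ a → length-filter-map-guarded (inBFrom k) (a ∷_) (k ≤ᵇ toℕ a) (inBFrom (toℕ a))
             (inBFrom-cons k a) (allWords ℓ m))

  -- Either the first letter is exactly a_{k+1}, or it is at least a_{k+2}.
  count-pascal : ∀ k m → k < ℓ → count k (suc m) ≡ count k m + count (suc k) (suc m)
  count-pascal k m k<ℓ = begin
    count k (suc m)                                                 ≡⟨ count-suc k m ⟩
    sumBelow ℓ (from k (λ a → count a m))                           ≡⟨ sumFrom-split ℓ k _ k<ℓ ⟩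
    count k m + sumBelow ℓ (from (suc k) (λ a → count a m))         ≡⟨ cong (count k m +_) (count-suc (suc k) m) ⟨
    count k m + count (suc k) (suc m)                               ∎
    where open ≡-Reasoning

  count-beyond : ∀ k m → ℓ ≤ k → count k (suc m) ≡ 0
  count-beyond k m ℓ≤k = trans (count-suc k m) (sumFrom-empty ℓ k _ ℓ≤k)

  -- Only the constant words a_ℓ^m start with the last letter.
  count-top : ∀ k → suc k ≡ ℓ → ∀ m → count k m ≡ 1
  count-top k e zero    = refl
  count-top k e (suc m) = trans (count-pascal k m (≤-reflexive e))
    (cong₂ _+_ (count-top k e m) (count-beyond (suc k) m (≤-reflexive (sym e))))

  count-closed : ∀ r k → k + suc r ≡ ℓ → ∀ m → r ! * count k m ≡ rising r (suc m)
  count-closed zero    k e m       = trans (+-identityʳ (count k m)) (count-top k (trans (+-comm 1 k) e) m)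
  count-closed (suc r) k e zero    = trans (*-identityʳ (suc r !)) (sym (rising-one (suc r)))
  count-closed (suc r) k e (suc m) = begin
    suc r ! * count k (suc m)                                       ≡⟨ cong (suc r ! *_) (count-pascal k m k<ℓ) ⟩
    suc r ! * (count k m + count (suc k) (suc m))                   ≡⟨ factorial-split r (count k m) _ ⟩
    suc r ! * count k m + suc r * (r ! * count (suc k) (suc m))     ≡⟨ cong₂ _+_ (count-closed (suc r) k e m)
                                                                          (cong (suc r *_) (count-closed r (suc k) e′ (suc m))) ⟩
    rising (suc r) (suc m) + suc r * rising r (suc (suc m))         ≡⟨ rising-pascal r (suc m) ⟨
    rising (suc r) (suc (suc m))                                    ∎
    where
    open ≡-Reasoning
    e′ : suc k + suc r ≡ ℓ
    e′ = trans (sym (+-suc k (suc r))) e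
    k<ℓ : k < ℓ
    k<ℓ = subst (k <_) e (m<m+n k (s≤s z≤n))

entry : {P : A → Set} → ∀ xs k → All P xs → k < length xs →
  Σ A λ w → head (drop k xs) ≡ just w × P w
entry (x ∷ xs) zero    (px ∷ _)  _         = x , refl , px
entry (x ∷ xs) (suc k) (_ ∷ pxs) (s≤s k<n) = entry xs k pxs k<n

<ᵇ-true : ∀ {k n} → (k <ᵇ n) ≡ true → k < n
<ᵇ-true {k} {n} eq = <ᵇ⇒< k n (subst T (sym eq) tt)

<ᵇ-false : ∀ {k n} → (k <ᵇ n) ≡ false → n ≤ k
<ᵇ-false eq = ≮⇒≥ (λ k<n → subst T eq (<⇒<ᵇ k<n))

module Lengths (l : ℕ) where

  ℓ : ℕ
  ℓ = suc l

  open Counting ℓ using (count; count-closed)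

  W : ℕ → ℕ
  W m = length (wordsB ℓ m)

  W-closed : ∀ m → l ! * W m ≡ rising l (suc m)
  W-closed m = trans (cong (l ! *_) (length-filter-cong inB≡inBFrom0 (allWords ℓ m))) (count-closed l 0 refl m)
    where
    inB≡inBFrom0 : ∀ w → inBᵇ w ≡ Counting.inBFrom ℓ 0 w
    inB≡inBFrom0 []      = refl
    inB≡inBFrom0 (a ∷ w) = refl

  -- Every length occurs (e.g. a_1^m), which makes the enumeration's fuel sufficient.
  W-positive : ∀ m → 1 ≤ W m
  W-positive m = n≢0⇒n>0 λ W≡0 → <⇒≢ (rising-positive l m) (sym (begin
    rising l (suc m)     ≡⟨ W-closed m ⟨
    l ! * W m            ≡⟨ cong (l ! *_) W≡0 ⟩
    l ! * 0              ≡⟨ *-zeroʳ (l !) ⟩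
    0                    ∎))
    where open ≡-Reasoning

  countFrom : ℕ → ℕ → ℕ
  countFrom m zero    = 0
  countFrom m (suc d) = W m + countFrom (suc m) d

  countFrom-last : ∀ d m → countFrom m (suc d) ≡ countFrom m d + W (m + d)
  countFrom-last zero    m = trans (+-identityʳ (W m)) (cong W (sym (+-identityʳ m)))
  countFrom-last (suc d) m = begin
    W m + countFrom (suc m) (suc d)             ≡⟨ cong (W m +_) (countFrom-last d (suc m)) ⟩
    W m + (countFrom (suc m) d + W (suc m + d)) ≡⟨ +-assoc (W m) _ _ ⟨
    W m + countFrom (suc m) d + W (suc m + d)   ≡⟨ cong (λ z → W m + countFrom (suc m) d + W z) (+-suc m d) ⟨
    W m + countFrom (suc m) d + W (m + suc d)   ∎
    where open ≡-Reasoning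

  countFrom-≥ : ∀ d m → d ≤ countFrom m d
  countFrom-≥ zero    m = z≤n
  countFrom-≥ (suc d) m = +-mono-≤ (W-positive m) (countFrom-≥ d (suc m))

  S : ℕ → ℕ
  S = countFrom 0

  S-suc : ∀ m → S (suc m) ≡ S m + W m
  S-suc m = countFrom-last m 0

  -- S m = C(m+ℓ-1, ℓ), by the hockey-stick identity.
  S-closed : ∀ m → ℓ ! * S m ≡ rising ℓ m
  S-closed zero    = *-zeroʳ (ℓ !)
  S-closed (suc m) = begin
    ℓ ! * S (suc m)                         ≡⟨ cong (ℓ ! *_) (S-suc m) ⟩
    ℓ ! * (S m + W m)                       ≡⟨ factorial-split l (S m) (W m) ⟩
    ℓ ! * S m + ℓ * (l ! * W m)             ≡⟨ cong₂ _+_ (S-closed m) (cong (ℓ *_) (W-closed m)) ⟩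
    rising ℓ m + ℓ * rising l (suc m)       ≡⟨ rising-pascal l m ⟨
    rising ℓ (suc m)                        ∎
    where open ≡-Reasoning

  S-mono : ∀ {m m′} → m ≤ m′ → S m ≤ S m′
  S-mono {m} m≤m′ = subst (λ z → S m ≤ S z) (m+[n∸m]≡n m≤m′) (S-up m _)
    where
    S-up : ∀ m d → S m ≤ S (m + d)
    S-up m zero    = ≤-reflexive (cong S (sym (+-identityʳ m)))
    S-up m (suc d) = ≤-trans (S-up m d) (≤-trans (m≤m+n (S (m + d)) (W (m + d)))
                       (≤-reflexive (trans (sym (S-suc (m + d))) (cong S (sym (+-suc m d))))))

  allWords-length : ∀ m → All (λ w → length w ≡ m) (allWords ℓ m)
  allWords-length zero    = refl ∷ []
  allWords-length (suc m) =
    concat⁺ (map⁺ {f = λ a → map (a ∷_) (allWords ℓ m)}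
              (tabulate⁺ {f = id} λ _ → map⁺ (All.map (cong suc) (allWords-length m))))

  repGo-length : ∀ fuel m k → k < countFrom m fuel →
    Σ ℕ λ d → length (repGo ℓ fuel m k) ≡ m + d × countFrom m d ≤ k × k < countFrom m (suc d)
  repGo-length (suc fuel) m k k< with k <ᵇ W m in eq
  ... | true with entry (wordsB ℓ m) k (filter⁺ (T? ∘ inBᵇ) (allWords-length m)) (<ᵇ-true eq)
  ...   | w , found , |w| rewrite found =
    0 , trans |w| (sym (+-identityʳ m)) , z≤n , subst (k <_) (sym (+-identityʳ (W m))) (<ᵇ-true eq)
  repGo-length (suc fuel) m k k< | false =
    in-later-block (repGo-length fuel (suc m) (k ∸ W m) k′<)
    where
    k≡ : W m + (k ∸ W m) ≡ k
    k≡ = m+[n∸m]≡n (<ᵇ-false {k} {W m} eq)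
    k′< : k ∸ W m < countFrom (suc m) fuel
    k′< = +-cancelˡ-< (W m) _ _ (subst (_< countFrom m (suc fuel)) (sym k≡) k<)
    in-later-block : (Σ ℕ λ d → length (repGo ℓ fuel (suc m) (k ∸ W m)) ≡ suc m + d
                        × countFrom (suc m) d ≤ k ∸ W m × k ∸ W m < countFrom (suc m) (suc d)) →
                     Σ ℕ λ d → length (repGo ℓ fuel (suc m) (k ∸ W m)) ≡ m + d
                        × countFrom m d ≤ k × k < countFrom m (suc d)
    in-later-block (d , |w| , lo , hi) =
      suc d , trans |w| (sym (+-suc m d)) ,
      subst (W m + countFrom (suc m) d ≤_) k≡ (+-monoʳ-≤ (W m) lo) ,
      subst (_< W m + countFrom (suc m) (suc d)) k≡ (+-monoʳ-< (W m) hi)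

  L : ℕ → ℕ
  L x = length (rep ℓ x)

  rep-bracket : ∀ x → S (L x) ≤ x × x < S (suc (L x))
  rep-bracket x with repGo-length (suc x) 0 x (countFrom-≥ (suc x) 0)
  ... | d , |w| , lo , hi rewrite |w| = lo , hi

  L-≤ : ∀ x T → x < S (suc T) → L x ≤ T
  L-≤ x T x< = ≮⇒≥ λ T<L → <⇒≱ x< (≤-trans (S-mono T<L) (proj₁ (rep-bracket x)))

  ≤-L : ∀ x T → S T ≤ x → T ≤ L x
  ≤-L x T S≤ = ≮⇒≥ λ L<T → <⇒≱ (proj₂ (rep-bracket x)) (≤-trans (S-mono L<T) S≤)

prod : ℕ → (ℕ → ℕ) → ℕ
prod zero    f = 1
prod (suc n) f = f 0 * prod n (f ∘ suc)

prod-cong : ∀ n {f g : ℕ → ℕ} → (∀ j → f j ≡ g j) → prod n f ≡ prod n g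
prod-cong zero    e = refl
prod-cong (suc n) e = cong₂ _*_ (e 0) (prod-cong n (e ∘ suc))

prod-last : ∀ n f → prod (suc n) f ≡ prod n f * f n
prod-last zero    f = trans (*-identityʳ (f 0)) (sym (*-identityˡ (f 0)))
prod-last (suc n) f = trans (cong (f 0 *_) (prod-last n (f ∘ suc))) (sym (*-assoc (f 0) _ _))

rising-prod : ∀ r x → rising r x ≡ prod r (x +_)
rising-prod zero    x = refl
rising-prod (suc r) x = cong₂ _*_ (sym (+-identityʳ x))
  (trans (rising-prod r (suc x)) (prod-cong r (λ j → sym (+-suc x j))))

prod-scale : ∀ β n f → β ^ n * prod n f ≡ prod n (λ j → β * f j)
prod-scale β zero    f = refl
prod-scale β (suc n) f =
  trans (regroup β (β ^ n) (f 0) (prod n (f ∘ suc))) (cong (β * f 0 *_) (prod-scale β n (f ∘ suc)))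
  where
  regroup : ∀ b p x y → b * p * (x * y) ≡ b * x * (p * y)
  regroup = solve-∀

-- The factors of f are dominated by those of g in mirror-image pairs:
-- f i · f j ≤ g i · g j whenever i ≤ j and i + j = N - 1 (including i = j).
MirrorDominated : ℕ → (ℕ → ℕ) → (ℕ → ℕ) → Set
MirrorDominated N f g = ∀ i k → suc (i + (i + k)) ≡ N → f i * f (i + k) ≤ g i * g (i + k)

-- Squaring reflects ≤ (used for the middle factor when N is odd).
square-≤ : ∀ {x y} → x * x ≤ y * y → x ≤ y
square-≤ xx≤yy = ≮⇒≥ λ y<x → <⇒≱ (*-mono-< y<x y<x) xx≤yy

prod-mirror-≤ : ∀ N f g → MirrorDominated N f g → prod N f ≤ prod N g
prod-mirror-≤ zero          f g dom = ≤-refl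
prod-mirror-≤ (suc zero)    f g dom = *-monoˡ-≤ 1 (square-≤ {f 0} {g 0} (dom 0 0 refl))
prod-mirror-≤ (suc (suc N)) f g dom = begin
  f 0 * prod (suc N) (f ∘ suc)             ≡⟨ cong (f 0 *_) (prod-last N (f ∘ suc)) ⟩
  f 0 * (prod N (f ∘ suc) * f (suc N))     ≡⟨ outer-pair-first (f 0) _ _ ⟩
  f 0 * f (suc N) * prod N (f ∘ suc)       ≤⟨ *-mono-≤ (dom 0 (suc N) refl) (prod-mirror-≤ N (f ∘ suc) (g ∘ suc) inner) ⟩
  g 0 * g (suc N) * prod N (g ∘ suc)       ≡⟨ outer-pair-first (g 0) _ _ ⟨
  g 0 * (prod N (g ∘ suc) * g (suc N))     ≡⟨ cong (g 0 *_) (prod-last N (g ∘ suc)) ⟨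
  g 0 * prod (suc N) (g ∘ suc)             ∎
  where
  open ≤-Reasoning
  outer-pair-first : ∀ x p y → x * (p * y) ≡ x * y * p
  outer-pair-first = solve-∀
  inner : MirrorDominated N (f ∘ suc) (g ∘ suc)
  inner i k e = dom (suc i) k (cong (suc ∘ suc) (trans (+-suc i (i + k)) e))

product-≤-balanced : ∀ p q u v → p ≤ u → p ≤ v → p + q ≤ u + v → p * q ≤ u * v
product-≤-balanced p q u v p≤u p≤v sum≤ = begin
  p * q              ≤⟨ *-monoʳ-≤ p q≤ ⟩
  p * (e + v)        ≡⟨ *-distribˡ-+ p e v ⟩
  p * e + p * v      ≤⟨ +-monoˡ-≤ (p * v) (*-monoˡ-≤ e p≤v) ⟩
  v * e + p * v      ≡⟨ collect v e p ⟩
  (p + e) * v        ≡⟨ cong (_* v) u≡ ⟩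
  u * v              ∎
  where
  open ≤-Reasoning
  e : ℕ
  e = u ∸ p
  u≡ : p + e ≡ u
  u≡ = m+[n∸m]≡n p≤u
  q≤ : q ≤ e + v
  q≤ = +-cancelˡ-≤ p q (e + v) (subst (p + q ≤_) (trans (cong (_+ v) (sym u≡)) (+-assoc p e v)) sum≤)
  collect : ∀ v e p → v * e + p * v ≡ (p + e) * v
  collect = solve-∀

-- If u + v < p + q, v - u ≤ q - p, and u exceeds p by at most E while v ≤ p + K
-- with E·K ≤ p, then uv ≤ pq:  writing u = p + e, the excess e·v ≤ e(p + K)
-- is paid for by one extra unit of q.
product-≤-unbalanced : ∀ p q u v E K → suc (u + v) ≤ p + q → v + p ≤ q + u →
  u ≤ p + E → v ≤ p + K → E * K ≤ p → u * v ≤ p * q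
product-≤-unbalanced p q u v E K sum< gap u≤ v≤ EK≤p with u ≤? p
... | yes u≤p = *-mono-≤ u≤p (+-cancelʳ-≤ p v q (≤-trans gap (+-monoʳ-≤ q u≤p)))
... | no u≰p = begin
  u * v                      ≡⟨ cong (_* v) u≡ ⟨
  (p + e) * v                ≡⟨ *-distribʳ-+ v p e ⟩
  p * v + e * v              ≤⟨ +-monoʳ-≤ (p * v) (*-monoʳ-≤ e v≤) ⟩
  p * v + e * (p + K)        ≡⟨ expand p v e K ⟩
  p * v + p * e + e * K      ≤⟨ +-monoʳ-≤ (p * v + p * e) (≤-trans (*-monoˡ-≤ K e≤E) EK≤p) ⟩
  p * v + p * e + p          ≡⟨ collect p v e ⟩
  p * (v + e + 1)            ≤⟨ *-monoʳ-≤ p q≥ ⟩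
  p * q                      ∎
  where
  open ≤-Reasoning
  e : ℕ
  e = u ∸ p
  u≡ : p + e ≡ u
  u≡ = m+[n∸m]≡n (<⇒≤ (≰⇒> u≰p))
  e≤E : e ≤ E
  e≤E = +-cancelˡ-≤ p e E (subst (_≤ p + E) (sym u≡) u≤)
  expand : ∀ p v e K → p * v + e * (p + K) ≡ p * v + p * e + e * K
  expand = solve-∀
  collect : ∀ p v e → p * v + p * e + p ≡ p * (v + e + 1)
  collect = solve-∀
  shift : ∀ p v e → suc (p + e + v) ≡ p + (v + e + 1)
  shift = solve-∀
  q≥ : v + e + 1 ≤ q
  q≥ = +-cancelˡ-≤ p (v + e + 1) q (subst (_≤ p + q) (shift p v e) (subst (λ z → suc (z + v) ≤ p + q) (sym u≡) sum<))

half-≤ : ∀ {y c} → y + y ≤ c + c → y ≤ c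
half-≤ yy≤cc = ≮⇒≥ λ c<y → <⇒≱ (+-mono-< c<y c<y) yy≤cc

-- For β = b+1: a mirror pair (i, i+k) of factors of β^ℓ · rising ℓ (m+1),
-- with ℓ = 2i+k+1, is dominated by the matching pair of rising ℓ (βm+c+1)
-- as soon as b(ℓ+1) ≤ 2c.
pair-up : ∀ b c m i k → b * (suc (i + (i + k)) + 1) ≤ c + c →
  suc b * (suc m + i) * (suc b * (suc m + (i + k)))
    ≤ (suc (suc b * m + c) + i) * (suc (suc b * m + c) + (i + k))
pair-up b c m i k hc =
  product-≤-balanced _ _ _ _ p≤u (≤-trans p≤u (+-monoʳ-≤ (suc (suc b * m + c)) (m≤m+n i k)))
    (subst₂ _≤_ (sym (sum-p+q b m i k)) (sym (sum-u+v b m c i k)) (+-monoʳ-≤ (suc b * (m + m)) (+-monoʳ-≤ _ hc)))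
  where
  bi≤c : b * suc i ≤ c
  bi≤c = half-≤ (≤-trans (≤-trans (m≤m+n _ (b * k)) (≤-reflexive (double b i k))) hc)
    where
    double : ∀ b i k → b * suc i + b * suc i + b * k ≡ b * (suc (i + (i + k)) + 1)
    double = solve-∀
  p≤u : suc b * (suc m + i) ≤ suc (suc b * m + c) + i
  p≤u = subst₂ _≤_ (sym (expand-p b m i)) (sym (expand-u b m c i)) (+-monoʳ-≤ (suc b * m) (+-monoʳ-≤ (suc i) bi≤c))
    where
    expand-p : ∀ b m i → suc b * (suc m + i) ≡ suc b * m + (suc i + b * suc i)
    expand-p = solve-∀
    expand-u : ∀ b m c i → suc (suc b * m + c) + i ≡ suc b * m + (suc i + c)
    expand-u = solve-∀
  sum-p+q : ∀ b m i k → suc b * (suc m + i) + suc b * (suc m + (i + k))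
                        ≡ suc b * (m + m) + ((suc (i + (i + k)) + 1) + b * (suc (i + (i + k)) + 1))
  sum-p+q = solve-∀
  sum-u+v : ∀ b m c i k → (suc (suc b * m + c) + i) + (suc (suc b * m + c) + (i + k))
                          ≡ suc b * (m + m) + ((suc (i + (i + k)) + 1) + (c + c))
  sum-u+v = solve-∀

-- Conversely, the mirror pair (i, i+k) of rising ℓ (βm+c) is dominated by the
-- matching pair of β^ℓ · rising ℓ (m+1) when 2c ≤ b(ℓ+1)+1 and m ≥ c(c+ℓ).
pair-down : ∀ b c m i k → c + c ≤ suc (b * (suc (i + (i + k)) + 1)) → c * (c + suc (i + (i + k))) ≤ m →
  (suc b * m + c + i) * (suc b * m + c + (i + k))
    ≤ suc b * (suc m + i) * (suc b * (suc m + (i + k)))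
pair-down b c m i k hc hm = product-≤-unbalanced _ _ _ _ c (c + suc (i + (i + k))) sum< gap u≤ v≤ (≤-trans hm m≤p)
  where
  u v p q : ℕ
  u = suc b * m + c + i
  v = suc b * m + c + (i + k)
  p = suc b * (suc m + i)
  q = suc b * (suc m + (i + k))
  sum< : suc (u + v) ≤ p + q
  sum< = subst₂ _≤_ (sym (sum-u+v b m c i k)) (sym (sum-p+q b m i k))
           (+-monoʳ-≤ (suc b * (m + m)) (+-monoʳ-≤ (i + (i + k)) (s≤s hc)))
    where
    sum-u+v : ∀ b m c i k → suc ((suc b * m + c + i) + (suc b * m + c + (i + k)))
                            ≡ suc b * (m + m) + (i + (i + k) + suc (c + c))
    sum-u+v = solve-∀
    sum-p+q : ∀ b m i k → suc b * (suc m + i) + suc b * (suc m + (i + k))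
                          ≡ suc b * (m + m) + (i + (i + k) + suc (suc (b * (suc (i + (i + k)) + 1))))
    sum-p+q = solve-∀
  gap : v + p ≤ q + u
  gap = subst (v + p ≤_) (sym (gap-identity b m c i k)) (m≤m+n (v + p) (b * k))
    where
    gap-identity : ∀ b m c i k → suc b * (suc m + (i + k)) + (suc b * m + c + i)
                                 ≡ (suc b * m + c + (i + k)) + suc b * (suc m + i) + b * k
    gap-identity = solve-∀
  u≤ : u ≤ p + c
  u≤ = subst (u ≤_) (sym (identity b m c i)) (m≤m+n u _)
    where
    identity : ∀ b m c i → suc b * (suc m + i) + c ≡ (suc b * m + c + i) + suc (b * suc i)
    identity = solve-∀
  v≤ : v ≤ p + (c + suc (i + (i + k)))
  v≤ = subst (v ≤_) (sym (identity b m c i k)) (m≤m+n v _)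
    where
    identity : ∀ b m c i k → suc b * (suc m + i) + (c + suc (i + (i + k)))
                             ≡ (suc b * m + c + (i + k)) + (suc b * suc i + suc i)
    identity = solve-∀
  m≤p : m ≤ p
  m≤p = subst (m ≤_) (sym (identity b m i)) (m≤m+n m _)
    where
    identity : ∀ b m i → suc b * (suc m + i) ≡ m + (suc i + b * (suc m + i))
    identity = solve-∀

rising-up : ∀ b ℓ c m → b * (ℓ + 1) ≤ c + c →
  suc b ^ ℓ * rising ℓ (suc m) ≤ rising ℓ (suc (suc b * m + c))
rising-up b ℓ c m hc = begin
  suc b ^ ℓ * rising ℓ (suc m)                   ≡⟨ cong (suc b ^ ℓ *_) (rising-prod ℓ (suc m)) ⟩
  suc b ^ ℓ * prod ℓ (suc m +_)                  ≡⟨ prod-scale (suc b) ℓ (suc m +_) ⟩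
  prod ℓ (λ j → suc b * (suc m + j))             ≤⟨ prod-mirror-≤ ℓ _ _ dominated ⟩
  prod ℓ (suc (suc b * m + c) +_)                ≡⟨ rising-prod ℓ (suc (suc b * m + c)) ⟨
  rising ℓ (suc (suc b * m + c))                 ∎
  where
  open ≤-Reasoning
  dominated : MirrorDominated ℓ (λ j → suc b * (suc m + j)) (suc (suc b * m + c) +_)
  dominated i k e = pair-up b c m i k (subst (λ n → b * (n + 1) ≤ c + c) (sym e) hc)

rising-down : ∀ b ℓ c m → c + c ≤ suc (b * (ℓ + 1)) → c * (c + ℓ) ≤ m →
  rising ℓ (suc b * m + c) ≤ suc b ^ ℓ * rising ℓ (suc m)
rising-down b ℓ c m hc hm = begin
  rising ℓ (suc b * m + c)                       ≡⟨ rising-prod ℓ (suc b * m + c) ⟩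
  prod ℓ ((suc b * m + c) +_)                    ≤⟨ prod-mirror-≤ ℓ _ _ dominated ⟩
  prod ℓ (λ j → suc b * (suc m + j))             ≡⟨ prod-scale (suc b) ℓ (suc m +_) ⟨
  suc b ^ ℓ * prod ℓ (suc m +_)                  ≡⟨ cong (suc b ^ ℓ *_) (rising-prod ℓ (suc m)) ⟨
  suc b ^ ℓ * rising ℓ (suc m)                   ∎
  where
  open ≤-Reasoning
  dominated : MirrorDominated ℓ ((suc b * m + c) +_) (λ j → suc b * (suc m + j))
  dominated i k e = pair-down b c m i k (subst (λ n → c + c ≤ suc (b * (n + 1))) (sym e) hc)
                                        (subst (λ n → c * (c + n) ≤ m) (sym e) hm)

module Scaling (l : ℕ) where

  open Lengths l

  S-scale-up : ∀ b c m → b * (ℓ + 1) ≤ c + c → suc b ^ ℓ * S (suc m) ≤ S (suc (suc b * m + c))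
  S-scale-up b c m hc = *-cancelˡ-≤ (ℓ !) {{ℓ !≢0}} (begin
    ℓ ! * (suc b ^ ℓ * S (suc m))        ≡⟨ x∙yz≈y∙xz (ℓ !) (suc b ^ ℓ) (S (suc m)) ⟩
    suc b ^ ℓ * (ℓ ! * S (suc m))        ≡⟨ cong (suc b ^ ℓ *_) (S-closed (suc m)) ⟩
    suc b ^ ℓ * rising ℓ (suc m)         ≤⟨ rising-up b ℓ c m hc ⟩
    rising ℓ (suc (suc b * m + c))       ≡⟨ S-closed (suc (suc b * m + c)) ⟨
    ℓ ! * S (suc (suc b * m + c))        ∎)
    where open ≤-Reasoning

  S-scale-down : ∀ b c m → c + c ≤ suc (b * (ℓ + 1)) → c * (c + ℓ) ≤ m →
    S (suc b * m + c) ≤ suc b ^ ℓ * S (suc m)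
  S-scale-down b c m hc hm = *-cancelˡ-≤ (ℓ !) {{ℓ !≢0}} (begin
    ℓ ! * S (suc b * m + c)              ≡⟨ S-closed (suc b * m + c) ⟩
    rising ℓ (suc b * m + c)             ≤⟨ rising-down b ℓ c m hc hm ⟩
    suc b ^ ℓ * rising ℓ (suc m)         ≡⟨ cong (suc b ^ ℓ *_) (S-closed (suc m)) ⟨
    suc b ^ ℓ * (ℓ ! * S (suc m))        ≡⟨ x∙yz≈y∙xz (suc b ^ ℓ) (ℓ !) (S (suc m)) ⟩
    ℓ ! * (suc b ^ ℓ * S (suc m))        ∎)
    where open ≤-Reasoning

  -- With m+1 = |rep n| and M = |rep (β^ℓ n)|, the bracketing of n and the scaled
  -- inequalities give β^ℓ n < S (β(m+1)+c+1), so M ≤ β(m+1)+c, and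
  -- S (βm+c) ≤ β^ℓ n, so M ≥ βm+c.
  length-scale : ∀ b c → b * (ℓ + 1) ≤ c + c → c + c ≤ suc (b * (ℓ + 1)) →
    ∀ n → c * (c + ℓ) < L n → Σ ℕ λ i → i ≤ suc b × L (suc b ^ ℓ * n) + i ≡ suc b * L n + c
  length-scale b c hc₁ hc₂ n large with L n | rep-bracket n
  ... | suc m | S≤n , n<S = suc b * suc m + c ∸ M , i≤β , m+[n∸m]≡n M≤
    where
    M : ℕ
    M = L (suc b ^ ℓ * n)
    M≤ : M ≤ suc b * suc m + c
    M≤ = L-≤ _ _ (<-≤-trans (*-monoʳ-< (suc b ^ ℓ) {{m^n≢0 (suc b) ℓ}} n<S) (S-scale-up b c (suc m) hc₁))
    ≤M : suc b * m + c ≤ M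
    ≤M = ≤-L _ _ (≤-trans (S-scale-down b c m hc₂ (≤-pred large)) (*-monoʳ-≤ (suc b ^ ℓ) S≤n))
    i≤β : suc b * suc m + c ∸ M ≤ suc b
    i≤β = ≤-trans (∸-monoʳ-≤ (suc b * suc m + c) ≤M)
                  (≤-reflexive (trans (cong (_∸ (suc b * m + c)) (one-more b m c)) (m+n∸m≡n (suc b * m + c) (suc b))))
      where
      one-more : ∀ b m c → suc b * suc m + c ≡ (suc b * m + c) + suc b
      one-more = solve-∀

ceilHalf-bounds : ∀ x → x ≤ ceilHalf x + ceilHalf x × ceilHalf x + ceilHalf x ≤ suc x
ceilHalf-bounds x = lower , upper
  where
  c : ℕ
  c = ceilHalf x
  twice : c * 2 ≡ c + c
  twice = trans (*-comm c 2) (cong (c +_) (+-identityʳ c))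
  upper : c + c ≤ suc x
  upper = subst₂ _≤_ twice (+-comm x 1) (m/n*n≤m (x + 1) 2)
  lower : x ≤ c + c
  lower = ≤-pred (begin
    suc x                    ≡⟨ +-comm 1 x ⟩
    x + 1                    ≡⟨ m≡m%n+[m/n]*n (x + 1) 2 ⟩
    (x + 1) % 2 + c * 2      ≤⟨ +-mono-≤ (≤-pred (m%n<n (x + 1) 2)) (≤-reflexive twice) ⟩
    suc (c + c)              ∎)
    where open ≤-Reasoning

lemma25 : (ℓ β : ℕ) → 1 ≤ ℓ → 1 ≤ β →
    Σ ℕ (λ N → (n : ℕ) → N ≤ n →
    Σ ℕ (λ i → i ≤ β ×
    length (rep ℓ (β ^ ℓ * n)) + i
    ≡ β * length (rep ℓ n) + ceilHalf ((β ∸ 1) * (ℓ + 1))))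
lemma25 (suc l) (suc b) _ _ =
  S (suc threshold) , λ n N≤n → length-scale b c lower upper n (≤-L n (suc threshold) N≤n)
  where
  open Lengths l using (ℓ; S; ≤-L)
  open Scaling l using (length-scale)
  c threshold : ℕ
  c = ceilHalf (b * (ℓ + 1))
  threshold = c * (c + ℓ)
  lower : b * (ℓ + 1) ≤ c + c
  lower = proj₁ (ceilHalf-bounds (b * (ℓ + 1)))
  upper : c + c ≤ suc (b * (ℓ + 1))
  upper = proj₂ (ceilHalf-bounds (b * (ℓ + 1)))
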